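{- Let $(m_S,m_A)$ be an $f$-pair of statistics. Then for all $n\ge2$, $$\sum_{v\in A_{n+1}}q^{m_A(v)}t^{\mathrm{del}_A(v)}=\sum_{w\in S_n}q^{m_S(w)}(2t)^{\mathrm{del}_S(w)}.$$
   Context: Permutations are multiplied as functions; $s_i=(i,i+1)$. $R^S_j=\{1,s_j,\dots,s_j\cdots s_1\}$; every $w\in S_n$ factors uniquely as $w_1\cdots w_{n-1}$ with $w_j\in R^S_j$, and $\mathrm{del}_S(w)$ is the number of $j$ with $w_j=s_j\cdots s_1$. In $S_{n+1}$, $a_i=s_1s_{i+1}$ ($1\le i\le n-1$), $R^A_j=\{1,a_j,a_ja_{j-1},\dots,a_j\cdots a_2,a_j\cdots a_2a_1,a_j\cdots a_2a_1^{ -1}\}$ ($R^A_1=\{1,a_1,a_1^{ -1}\}$); every $v\in A_{n+1}$ factors uniquely as $v_1\cdots v_{n-1}$, $v_j\in R^A_j$, and $\mathrm{del}_A(v)$ is the number of letters $a_1^{\pm1}$. The map $f:A_{n+1}\to S_n$ is $f(v)=f(v_1)\cdots f(v_{n-1})$ with $f(1)=1$, $f(a_j\cdots a_k)=s_j\cdots s_k$ ($2\le k\le j$), $f(a_j\cdots a_2a_1^{\pm1})=s_j\cdots s_1$. A statistic $m_S$ assigns a nonnegative integer to each permutation of each symmetric group, and $m_A$ to each element of each alternating group; $(m_S,m_A)$ is an $f$-pair if $m_A(v)=m_S(f(v))$ for all $n$ and all $v\in A_{n+1}$. -}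

module Defs where

open import Level using (Level)
open import Data.Bool using (Bool; true; false; _∧_; if_then_else_; not)
open import Data.Nat using (ℕ; zero; suc; _∸_; _≤ᵇ_; _≡ᵇ_; _<ᵇ_)
import Data.Nat as N
open import Data.Fin using (Fin; zero; suc; toℕ)
import Data.Fin as F
open import Data.Vec using (Vec; []; _∷_; lookup; tabulate; map)
import Data.Vec.Properties as VP
import Data.Vec
open import Relation.Binary.PropositionalEquality using (_≡_)
open import Data.List as L using (List; []; _∷_; filterᵇ; findᵇ; foldr; concatMap; upTo)
open import Data.Maybe using (Maybe; just; nothing; maybe)
open import Relation.Nullary.Decidable using (⌊_⌋)
open import Algebra.Bundles using (CommutativeSemiring)
import Algebra.Definitions.RawSemiring as RS

-- Permutations of {1,…,n}, encoded 0-indexed as the vector of images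
-- (w(1),…,w(n)).  A vector is a permutation iff its entries are distinct.

Perm : ℕ → Set
Perm n = Vec (Fin n) n

idP : (n : ℕ) → Perm n
idP n = tabulate (λ i → i)

_∘P_ : {n : ℕ} → Perm n → Perm n → Perm n
u ∘P v = map (lookup u) v

allVecs : (n k : ℕ) → List (Vec (Fin n) k)
allVecs n zero    = [] ∷ []
allVecs n (suc k) = concatMap (λ x → L.map (x ∷_) (allVecs n k)) (L.allFin n)

notIn : {n k : ℕ} → Fin n → Vec (Fin n) k → Bool
notIn x []       = true
notIn x (y ∷ ys) = not ⌊ x F.≟ y ⌋ ∧ notIn x ys

distinct : {n k : ℕ} → Vec (Fin n) k → Bool
distinct []       = true
distinct (x ∷ xs) = notIn x xs ∧ distinct xs

isPerm : {n : ℕ} → Perm n → Bool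
isPerm = distinct

invCount : {n k : ℕ} → Vec (Fin n) k → ℕ
invCount []       = 0
invCount (x ∷ xs) = L.length (filterᵇ (λ y → toℕ y <ᵇ toℕ x) (Data.Vec.toList xs)) N.+ invCount xs

isEvenℕ : ℕ → Bool
isEvenℕ zero          = true
isEvenℕ (suc zero)    = false
isEvenℕ (suc (suc k)) = isEvenℕ k

inS : {n : ℕ} → Perm n → Bool
inS = isPerm

inA : {n : ℕ} → Perm n → Bool
inA w = isPerm w ∧ isEvenℕ (invCount w)

S-list : (n : ℕ) → List (Perm n)
S-list n = filterᵇ inS (allVecs n n)

A-list : (n : ℕ) → List (Perm n)
A-list n = filterᵇ inA (allVecs n n)

-- Simple transpositions.  swapAt k swaps the 0-indexed points k, k+1
-- (identity if out of range).  s n i = s_i = (i, i+1) in S_n (1-indexed).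

swapAt : {n : ℕ} → ℕ → Fin n → Fin n
swapAt {suc zero}    zero    zero          = zero
swapAt {suc (suc n)} zero    zero          = suc zero
swapAt               zero    (suc zero)    = zero
swapAt               zero    (suc (suc x)) = suc (suc x)
swapAt               (suc k) zero          = zero
swapAt               (suc k) (suc x)       = suc (swapAt k x)

s : (n i : ℕ) → Perm n
s n zero    = idP n
s n (suc k) = tabulate (swapAt k)

descS : (n j k : ℕ) → Perm n
descS n j zero    = idP n
descS n j (suc k) = s n j ∘P descS n (j ∸ 1) k

a : (n i : ℕ) → Perm (suc n)
a n i = s (suc n) 1 ∘P s (suc n) (suc i)

a1inv : (n : ℕ) → Perm (suc n)
a1inv n = s (suc n) 2 ∘P s (suc n) 1

descA : (n j k : ℕ) → Perm (suc n)
descA n j zero    = idP (suc n)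
descA n j (suc k) = a n j ∘P descA n (j ∸ 1) k

-- Coset representatives, indexed by a choice k:
-- R^S_j : k = 0,…,j  ↦  s_j⋯s_{j-k+1}   (k = j is s_j⋯s_1)
-- R^A_j : k = 0,…,j  ↦  a_j⋯a_{j-k+1}   (k = j is a_j⋯a_2a_1)
--         k = j+1    ↦  a_j⋯a_2a_1^{-1}

elemS : (n j k : ℕ) → Perm n
elemS = descS

elemA : (n j k : ℕ) → Perm (suc n)
elemA n j k = if k ≤ᵇ j then descA n j k else (descA n j (j ∸ 1) ∘P a1inv n)

choices : (ℕ → ℕ) → ℕ → List (List ℕ)
choices b zero    = [] ∷ []
choices b (suc m) = concatMap (λ ks → L.map (λ k → ks L.++ (k ∷ [])) (upTo (suc (b (suc m)))))
                              (choices b m)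

choicesS : ℕ → List (List ℕ)
choicesS n = choices (λ j → j) (n ∸ 1)

choicesA : ℕ → List (List ℕ)
choicesA n = choices suc (n ∸ 1)

prodFrom : {N : ℕ} → (ℕ → ℕ → Perm N) → Perm N → ℕ → List ℕ → Perm N
prodFrom e one j []       = one
prodFrom e one j (k ∷ ks) = e j k ∘P prodFrom e one (suc j) ks

prodS : (n : ℕ) → List ℕ → Perm n
prodS n = prodFrom (elemS n) (idP n) 1

prodA : (n : ℕ) → List ℕ → Perm (suc n)
prodA n = prodFrom (elemA n) (idP (suc n)) 1

_==P_ : {n : ℕ} → Perm n → Perm n → Bool
u ==P v = ⌊ VP.≡-dec F._≟_ u v ⌋

factorS : (n : ℕ) → Perm n → Maybe (List ℕ)
factorS n w = findᵇ (λ ks → prodS n ks ==P w) (choicesS n)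

factorA : (n : ℕ) → Perm (suc n) → Maybe (List ℕ)
factorA n v = findᵇ (λ ks → prodA n ks ==P v) (choicesA n)

countFrom : (ℕ → ℕ → Bool) → ℕ → List ℕ → ℕ
countFrom p j []       = 0
countFrom p j (k ∷ ks) = (if p j k then 1 else 0) N.+ countFrom p (suc j) ks

delS : (n : ℕ) → Perm n → ℕ
delS n w = maybe (countFrom (λ j k → k ≡ᵇ j) 1) 0 (factorS n w)

-- del_A(v): number of letters a_1^{±1}, i.e. of j with k_j ∈ {j, j+1}
delA : (n : ℕ) → Perm (suc n) → ℕ
delA n v = maybe (countFrom (λ j k → j ≤ᵇ k) 1) 0 (factorA n v)

fElem : (n j k : ℕ) → Perm n
fElem n j k = if k ≤ᵇ j then descS n j k else descS n j j

f : (n : ℕ) → Perm (suc n) → Perm n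
f n v = maybe (prodFrom (fElem n) (idP n) 1) (idP n) (factorA n v)

-- Statistics and f-pairs.  A statistic is given on every Perm n
-- (only its values on S_n, resp. A_n, matter).

Statistic : Set
Statistic = (n : ℕ) → Perm n → ℕ

IsFPair : Statistic → Statistic → Set
IsFPair mS mA = (n : ℕ) (v : Perm (suc n)) → inA v ≡ true → mA (suc n) v ≡ mS n (f n v)

module _ {c ℓ : Level} (R : CommutativeSemiring c ℓ) where
  open CommutativeSemiring R
  open RS rawSemiring using (_^_)

  sumR : {X : Set} → (X → Carrier) → List X → Carrier
  sumR g = foldr (λ x acc → g x + acc) 0#

  genA : Statistic → (n : ℕ) → Carrier → Carrier → Carrier
  genA mA n q t = sumR (λ v → (q ^ mA (suc n) v) * (t ^ delA n v)) (A-list (suc n))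

  genS : Statistic → (n : ℕ) → Carrier → Carrier → Carrier
  genS mS n q t = sumR (λ w → (q ^ mS n w) * (((1# + 1#) * t) ^ delS n w)) (S-list n)

module Submission where

-- Every v ∈ A_{n+1} and every w ∈ S_n factors uniquely into coset representatives, so
-- both sums run over choice sequences (k_1, …, k_{n-1}) with k_j ≤ j + 1, resp. k_j ≤ j.
-- On these sequences del_A, del_S and f act letterwise: f replaces k_j by min(k_j, j), so
-- the two choices a_j⋯a_2a_1 and a_j⋯a_2a_1⁻¹ both go to s_j⋯s_1 while every other
-- S-choice has a single preimage. As m_A = m_S ∘ f and del_A = del_S ∘ f, an S-sequence
-- with del_S = d has 2^d preimages, each contributing q^{m_S(w)} t^d.
-- Unique factorization comes from iterated coset decompositions: modulo the subgroup
-- fixing every point ≥ T, the coset of w is determined by the point w⁻¹(T).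

open import Defs
open import Level using (Level)
open import Function using (id; _∘_; case_of_)
open import Function.Definitions using (Injective)
open import Data.Empty using (⊥-elim)
open import Data.Unit using (tt)
open import Data.Bool using (Bool; true; false; T; not; if_then_else_)
open import Data.Bool.Properties using (not-involutive; T-≡; ∧-conicalˡ; ∧-conicalʳ)
open import Function.Bundles using (Equivalence; mk⇔)
open import Data.Product using (∃; ∃₂; _×_; _,_; proj₁; proj₂)
open import Data.Sum using (_⊎_; inj₁; inj₂)
open import Data.Nat as ℕ
  using (ℕ; zero; suc; _∸_; _≤_; _<_; z≤n; s≤s; _≤ᵇ_; _<ᵇ_; _≡ᵇ_)
import Data.Nat.Properties as ℕ
open import Algebra.Properties.CommutativeSemigroup ℕ.+-commutativeSemigroup
  using () renaming (x∙yz≈y∙xz to +-left-comm)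
open import Data.Fin using (Fin; zero; suc; toℕ; fromℕ<; punchOut)
import Data.Fin.Properties as Fin
open import Data.Vec using (Vec; []; _∷_; lookup; tabulate; toList)
import Data.Vec.Properties as Vec
open import Data.List as List
  using (List; []; _∷_; _++_; _∷ʳ_; upTo; allFin; concatMap; cartesianProductWith; filterᵇ)
import Data.List.Properties as List
open import Data.List.Membership.Propositional using (_∈_)
open import Data.List.Membership.Propositional.Properties
  using (∈-cartesianProductWith⁺; ∈-cartesianProductWith⁻; ∈-upTo⁺; ∈-upTo⁻; ∈-allFin;
         ∈-map⁺; ∈-map⁻; ∈-filter⁺; ∈-filter⁻)
open import Data.List.Membership.Propositional.Properties.WithK using (unique∧set⇒bag)
open import Data.List.Relation.Binary.BagAndSetEquality using (∼bag⇒↭)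
open import Data.Maybe using (just)
open import Data.List.Relation.Unary.Any using (here; there)
open import Data.List.Relation.Unary.Unique.Propositional using (Unique)
import Data.List.Relation.Unary.Unique.Propositional.Properties as Unique
import Data.List.Relation.Unary.AllPairs as AllPairs
import Data.List.Relation.Unary.All as All
open import Data.List.Relation.Binary.Permutation.Propositional using (_↭_; ↭-sym; ↭⇒↭ₛ′)
import Data.List.Relation.Binary.Permutation.Propositional.Properties as ↭
import Data.List.Relation.Binary.Permutation.Setoid.Properties as ↭ₛ
open import Algebra.Bundles using (CommutativeSemiring)
open import Relation.Nullary using (¬_; yes; no)
open import Relation.Nullary.Decidable using (T?; toWitness; fromWitness)
open import Relation.Binary.PropositionalEquality
  using (_≡_; _≢_; refl; sym; trans; cong; cong₂; subst; subst₂; module ≡-Reasoning)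

T⇒≡true : ∀ {b} → T b → b ≡ true
T⇒≡true = Equivalence.to T-≡

≡true⇒T : ∀ {b} → b ≡ true → T b
≡true⇒T = Equivalence.from T-≡

refutes⇒≡false : ∀ {b : Bool} {P : Set} → (T b → P) → ¬ P → b ≡ false
refutes⇒≡false {false} _     _  = refl
refutes⇒≡false {true}  sound ¬p = ⊥-elim (¬p (sound tt))

lookup-∘P : ∀ {n} (u v : Perm n) i → lookup (u ∘P v) i ≡ lookup u (lookup v i)
lookup-∘P u v i = Vec.lookup-map i (lookup u) v

lookup-idP : ∀ {n} (i : Fin n) → lookup (idP n) i ≡ i
lookup-idP = Vec.lookup∘tabulate id

lookup-extensionality : ∀ {A : Set} {n} {u v : Vec A n} →
                        (∀ i → lookup u i ≡ lookup v i) → u ≡ v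
lookup-extensionality {u = u} {v} eq = begin
  u                  ≡⟨ Vec.tabulate∘lookup u ⟨
  tabulate (lookup u) ≡⟨ Vec.tabulate-cong eq ⟩
  tabulate (lookup v) ≡⟨ Vec.tabulate∘lookup v ⟩
  v                  ∎
  where open ≡-Reasoning

∘P-assoc : ∀ {n} (u v w : Perm n) → u ∘P (v ∘P w) ≡ (u ∘P v) ∘P w
∘P-assoc u v w = lookup-extensionality λ i → begin
  lookup (u ∘P (v ∘P w)) i      ≡⟨ lookup-∘P u (v ∘P w) i ⟩
  lookup u (lookup (v ∘P w) i)  ≡⟨ cong (lookup u) (lookup-∘P v w i) ⟩
  lookup u (lookup v (lookup w i)) ≡⟨ lookup-∘P u v (lookup w i) ⟨
  lookup (u ∘P v) (lookup w i)  ≡⟨ lookup-∘P (u ∘P v) w i ⟨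
  lookup ((u ∘P v) ∘P w) i      ∎
  where open ≡-Reasoning

∘P-identityˡ : ∀ {n} (u : Perm n) → idP n ∘P u ≡ u
∘P-identityˡ {n} u = lookup-extensionality λ i →
  trans (lookup-∘P (idP n) u i) (lookup-idP _)

∘P-identityʳ : ∀ {n} (u : Perm n) → u ∘P idP n ≡ u
∘P-identityʳ {n} u = lookup-extensionality λ i →
  trans (lookup-∘P u (idP n) i) (cong (lookup u) (lookup-idP i))

Distinct : ∀ {n k} → Vec (Fin n) k → Set
Distinct w = Injective _≡_ _≡_ (lookup w)

idP-Distinct : ∀ {n} → Distinct (idP n)
idP-Distinct {x = x} {y} eq = trans (sym (lookup-idP x)) (trans eq (lookup-idP y))

∘P-Distinct : ∀ {n} (u v : Perm n) → Distinct u → Distinct v → Distinct (u ∘P v)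
∘P-Distinct u v u-inj v-inj {x} {y} eq =
  v-inj (u-inj (trans (sym (lookup-∘P u v x)) (trans eq (lookup-∘P u v y))))

injective⇒surjective : ∀ {n} (g : Fin n → Fin n) → Injective _≡_ _≡_ g →
                       ∀ y → ∃ λ x → g x ≡ y
injective⇒surjective {suc n} g g-inj y with Fin.any? (λ x → g x Fin.≟ y)
... | yes hit = hit
... | no miss
  with i , j , i<j , eq ← Fin.pigeonhole (ℕ.n<1+n n)
                            (λ x → punchOut {i = y} {j = g x} (λ e → miss (x , sym e)))
  = ⊥-elim (Fin.<-irrefl (g-inj (Fin.punchOut-injective {i = y} _ _ eq)) i<j)

Distinct⇒surjective : ∀ {n} (w : Perm n) → Distinct w → ∀ y → ∃ λ x → lookup w x ≡ y
Distinct⇒surjective w = injective⇒surjective (lookup w)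

notIn⇒∉ : ∀ {n k} (x : Fin n) (xs : Vec (Fin n) k) → notIn x xs ≡ true →
          ∀ i → lookup xs i ≢ x
notIn⇒∉ x (y ∷ ys) h i eq with x Fin.≟ y | i
... | no x≢y | zero  = x≢y (sym eq)
... | no _   | suc i = notIn⇒∉ x ys h i eq

∉⇒notIn : ∀ {n k} (x : Fin n) (xs : Vec (Fin n) k) → (∀ i → lookup xs i ≢ x) →
          notIn x xs ≡ true
∉⇒notIn x []       _ = refl
∉⇒notIn x (y ∷ ys) h with x Fin.≟ y
... | yes x≡y = ⊥-elim (h zero (sym x≡y))
... | no _    = ∉⇒notIn x ys (h ∘ suc)

distinct⇒Distinct : ∀ {n k} (w : Vec (Fin n) k) → distinct w ≡ true → Distinct w
distinct⇒Distinct (x ∷ xs) h {zero}  {zero}  eq = refl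
distinct⇒Distinct (x ∷ xs) h {zero}  {suc j} eq =
  ⊥-elim (notIn⇒∉ x xs (∧-conicalˡ (notIn x xs) (distinct xs) h) j (sym eq))
distinct⇒Distinct (x ∷ xs) h {suc i} {zero}  eq =
  ⊥-elim (notIn⇒∉ x xs (∧-conicalˡ (notIn x xs) (distinct xs) h) i eq)
distinct⇒Distinct (x ∷ xs) h {suc i} {suc j} eq =
  cong suc (distinct⇒Distinct xs (∧-conicalʳ (notIn x xs) (distinct xs) h) eq)

Distinct⇒distinct : ∀ {n k} (w : Vec (Fin n) k) → Distinct w → distinct w ≡ true
Distinct⇒distinct []       _     = refl
Distinct⇒distinct (x ∷ xs) w-inj
  rewrite ∉⇒notIn x xs (λ i eq → case w-inj {suc i} {zero} eq of λ ())
  = Distinct⇒distinct xs (Fin.suc-injective ∘ w-inj)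

FixesFrom : ∀ {n} → ℕ → Perm n → Set
FixesFrom c w = ∀ x → c ≤ toℕ x → lookup w x ≡ x

∘P-FixesFrom : ∀ {n c} (u v : Perm n) → FixesFrom c u → FixesFrom c v → FixesFrom c (u ∘P v)
∘P-FixesFrom u v u-fix v-fix x c≤x =
  trans (lookup-∘P u v x) (trans (cong (lookup u) (v-fix x c≤x)) (u-fix x c≤x))

FixesFrom-mono : ∀ {n c d} (u : Perm n) → c ≤ d → FixesFrom c u → FixesFrom d u
FixesFrom-mono u c≤d u-fix x d≤x = u-fix x (ℕ.≤-trans c≤d d≤x)

swapAt-involutive : ∀ {n} k (x : Fin n) → swapAt k (swapAt k x) ≡ x
swapAt-involutive {suc zero}    zero    zero          = refl
swapAt-involutive {suc (suc n)} zero    zero          = refl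
swapAt-involutive               zero    (suc zero)    = refl
swapAt-involutive               zero    (suc (suc x)) = refl
swapAt-involutive               (suc k) zero          = refl
swapAt-involutive               (suc k) (suc x)       = cong suc (swapAt-involutive k x)

swapAt-injective : ∀ {n} k → Injective _≡_ _≡_ (swapAt {n} k)
swapAt-injective k {x} {y} eq =
  trans (sym (swapAt-involutive k x)) (trans (cong (swapAt k) eq) (swapAt-involutive k y))

swapAt-fixesAbove : ∀ {n} k (x : Fin n) → suc k < toℕ x → swapAt k x ≡ x
swapAt-fixesAbove zero    (suc zero)    (s≤s ())
swapAt-fixesAbove zero    (suc (suc x)) _          = refl
swapAt-fixesAbove (suc k) (suc x)       (s≤s k<x) = cong suc (swapAt-fixesAbove k x k<x)

toℕ-swapAt-up : ∀ {n} k (x : Fin n) → toℕ x ≡ k → suc k < n → toℕ (swapAt k x) ≡ suc k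
toℕ-swapAt-up {suc zero}    zero    zero    _  (s≤s ())
toℕ-swapAt-up {suc (suc n)} zero    zero    _  _         = refl
toℕ-swapAt-up               (suc k) (suc x) eq (s≤s k<n) =
  cong suc (toℕ-swapAt-up k x (ℕ.suc-injective eq) k<n)

lookup-s : ∀ n k (x : Fin n) → lookup (s n (suc k)) x ≡ swapAt k x
lookup-s n k = Vec.lookup∘tabulate (swapAt k)

s-Distinct : ∀ n i → Distinct (s n i)
s-Distinct n zero    = idP-Distinct
s-Distinct n (suc k) {x} {y} eq =
  swapAt-injective k (trans (sym (lookup-s n k x)) (trans eq (lookup-s n k y)))

s-FixesFrom : ∀ n i → FixesFrom (suc i) (s n i)
s-FixesFrom n zero    x _   = lookup-idP x
s-FixesFrom n (suc k) x i<x = trans (lookup-s n k x) (swapAt-fixesAbove k x i<x)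

swapAdjacent : ∀ {A : Set} {k} → ℕ → Vec A k → Vec A k
swapAdjacent zero    []           = []
swapAdjacent zero    (x ∷ [])     = x ∷ []
swapAdjacent zero    (x ∷ y ∷ xs) = y ∷ x ∷ xs
swapAdjacent (suc i) []           = []
swapAdjacent (suc i) (x ∷ xs)     = x ∷ swapAdjacent i xs

lookup-swapAdjacent : ∀ {A : Set} {k} i (u : Vec A k) x →
                      lookup (swapAdjacent i u) x ≡ lookup u (swapAt i x)
lookup-swapAdjacent zero    (y ∷ [])    zero          = refl
lookup-swapAdjacent zero    (y ∷ z ∷ u) zero          = refl
lookup-swapAdjacent zero    (y ∷ z ∷ u) (suc zero)    = refl
lookup-swapAdjacent zero    (y ∷ z ∷ u) (suc (suc x)) = refl
lookup-swapAdjacent (suc i) (y ∷ u)     zero          = refl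
lookup-swapAdjacent (suc i) (y ∷ u)     (suc x)       = lookup-swapAdjacent i u x

∘P-s≡swapAdjacent : ∀ {n} (u : Perm n) i → u ∘P s n (suc i) ≡ swapAdjacent i u
∘P-s≡swapAdjacent {n} u i = lookup-extensionality λ x →
  trans (lookup-∘P u (s n (suc i)) x)
        (trans (cong (lookup u) (lookup-s n i x)) (sym (lookup-swapAdjacent i u x)))

bit : Bool → ℕ
bit b = if b then 1 else 0

countᵇ : ∀ {A : Set} {k} → (A → Bool) → Vec A k → ℕ
countᵇ p xs = List.length (filterᵇ p (toList xs))

countᵇ-∷ : ∀ {A : Set} {k} (p : A → Bool) y (ys : Vec A k) →
           countᵇ p (y ∷ ys) ≡ bit (p y) ℕ.+ countᵇ p ys
countᵇ-∷ p y ys with p y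
... | true  = refl
... | false = refl

countᵇ-swapAdjacent : ∀ {A : Set} {k} (p : A → Bool) i (xs : Vec A k) →
                      countᵇ p (swapAdjacent i xs) ≡ countᵇ p xs
countᵇ-swapAdjacent p zero    []           = refl
countᵇ-swapAdjacent p zero    (x ∷ [])     = refl
countᵇ-swapAdjacent p zero    (x ∷ y ∷ xs)
  rewrite countᵇ-∷ p y (x ∷ xs) | countᵇ-∷ p x xs
        | countᵇ-∷ p x (y ∷ xs) | countᵇ-∷ p y xs
  = +-left-comm (bit (p y)) (bit (p x)) (countᵇ p xs)
countᵇ-swapAdjacent p (suc i) []           = refl
countᵇ-swapAdjacent p (suc i) (x ∷ xs)
  rewrite countᵇ-∷ p x (swapAdjacent i xs) | countᵇ-∷ p x xs
  = cong (bit (p x) ℕ.+_) (countᵇ-swapAdjacent p i xs)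

below : ∀ {n} → Fin n → Fin n → Bool
below x y = toℕ y <ᵇ toℕ x

OneApart : ℕ → ℕ → Set
OneApart a b = a ≡ suc b ⊎ b ≡ suc a

invCount-swapHead : ∀ {n k} (x y : Fin n) (xs : Vec (Fin n) k) → x ≢ y →
                 OneApart (invCount (y ∷ x ∷ xs)) (invCount (x ∷ y ∷ xs))
invCount-swapHead x y xs x≢y
  rewrite countᵇ-∷ (below x) y xs | countᵇ-∷ (below y) x xs
  with below x y in y<x | below y x in x<y
... | true  | false = inj₂ (cong suc (+-left-comm (countᵇ (below x) xs) (countᵇ (below y) xs) (invCount xs)))
... | false | true  = inj₁ (cong suc (+-left-comm (countᵇ (below y) xs) (countᵇ (below x) xs) (invCount xs)))
... | true  | true  = ⊥-elim (ℕ.<-asym (ℕ.<ᵇ⇒< (toℕ y) (toℕ x) (≡true⇒T y<x))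
                                       (ℕ.<ᵇ⇒< (toℕ x) (toℕ y) (≡true⇒T x<y)))
... | false | false = ⊥-elim (x≢y (Fin.toℕ-injective (ℕ.≤-antisym
                        (ℕ.≮⇒≥ (subst T y<x ∘ ℕ.<⇒<ᵇ)) (ℕ.≮⇒≥ (subst T x<y ∘ ℕ.<⇒<ᵇ)))))

invCount-swapAdjacent : ∀ {n k} i (u : Vec (Fin n) k) → Distinct u → suc i < k →
                        OneApart (invCount (swapAdjacent i u)) (invCount u)
invCount-swapAdjacent zero    (x ∷ y ∷ xs) u-inj _ =
  invCount-swapHead x y xs (λ eq → case u-inj {zero} {suc zero} eq of λ ())
invCount-swapAdjacent zero    (x ∷ [])     _     (s≤s ())
invCount-swapAdjacent (suc i) (x ∷ xs)     u-inj (s≤s i<k)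
  rewrite countᵇ-swapAdjacent (below x) i xs
  with invCount-swapAdjacent i xs (Fin.suc-injective ∘ u-inj) i<k
... | inj₁ eq = inj₁ (trans (cong (countᵇ (below x) xs ℕ.+_) eq) (ℕ.+-suc _ _))
... | inj₂ eq = inj₂ (trans (cong (countᵇ (below x) xs ℕ.+_) eq) (ℕ.+-suc _ _))

isEvenℕ-suc : ∀ m → isEvenℕ (suc m) ≡ not (isEvenℕ m)
isEvenℕ-suc zero          = refl
isEvenℕ-suc (suc zero)    = refl
isEvenℕ-suc (suc (suc m)) = isEvenℕ-suc m

isEvenℕ-OneApart : ∀ {a b} → OneApart a b → isEvenℕ a ≡ not (isEvenℕ b)
isEvenℕ-OneApart {b = b} (inj₁ refl) = isEvenℕ-suc b
isEvenℕ-OneApart {a = a} (inj₂ refl) =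
  trans (sym (not-involutive (isEvenℕ a))) (cong not (sym (isEvenℕ-suc a)))

isEven : ∀ {n k} → Vec (Fin n) k → Bool
isEven u = isEvenℕ (invCount u)

isEven-∘P-s : ∀ {n} (u : Perm n) i → Distinct u → suc i < n →
              isEven (u ∘P s n (suc i)) ≡ not (isEven u)
isEven-∘P-s u i u-inj i<n = trans (cong isEven (∘P-s≡swapAdjacent u i))
  (isEvenℕ-OneApart (invCount-swapAdjacent i u u-inj i<n))

ParityPreserving : ∀ {n} → Perm n → Set
ParityPreserving {n} r = ∀ (u : Perm n) → Distinct u → isEven (u ∘P r) ≡ isEven u

idP-ParityPreserving : ∀ {n} → ParityPreserving (idP n)
idP-ParityPreserving u _ = cong isEven (∘P-identityʳ u)

∘P-ParityPreserving : ∀ {n} (r r′ : Perm n) → Distinct r →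
                      ParityPreserving r → ParityPreserving r′ → ParityPreserving (r ∘P r′)
∘P-ParityPreserving r r′ r-inj r-even r′-even u u-inj =
  trans (cong isEven (∘P-assoc u r r′))
        (trans (r′-even (u ∘P r) (∘P-Distinct u r u-inj r-inj)) (r-even u u-inj))

s∘s-ParityPreserving : ∀ {n} i j → suc i < n → suc j < n →
                       ParityPreserving (s n (suc i) ∘P s n (suc j))
s∘s-ParityPreserving {n} i j i<n j<n u u-inj =
  trans (cong isEven (∘P-assoc u (s n (suc i)) (s n (suc j))))
  (trans (isEven-∘P-s (u ∘P s n (suc i)) j (∘P-Distinct u (s n (suc i)) u-inj (s-Distinct n (suc i))) j<n)
  (trans (cong not (isEven-∘P-s u i u-inj i<n)) (not-involutive _)))

countᵇ-below-min : ∀ {n k} (x : Fin n) (xs : Vec (Fin n) k) →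
                   (∀ i → toℕ x ≤ toℕ (lookup xs i)) → countᵇ (below x) xs ≡ 0
countᵇ-below-min x []       _   = refl
countᵇ-below-min x (y ∷ xs) x≤ rewrite countᵇ-∷ (below x) y xs
  with below x y in y<x
... | false = countᵇ-below-min x xs (x≤ ∘ suc)
... | true  = ⊥-elim (ℕ.<⇒≱ (ℕ.<ᵇ⇒< (toℕ y) (toℕ x) (≡true⇒T y<x)) (x≤ zero))

Ascending : ∀ {n k} → Vec (Fin n) k → Set
Ascending xs = ∀ i j → toℕ i ≤ toℕ j → toℕ (lookup xs i) ≤ toℕ (lookup xs j)

invCount-Ascending : ∀ {n k} (xs : Vec (Fin n) k) → Ascending xs → invCount xs ≡ 0
invCount-Ascending []       _   = refl
invCount-Ascending (x ∷ xs) asc =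
  cong₂ ℕ._+_ (countᵇ-below-min x xs (λ i → asc zero (suc i) z≤n))
            (invCount-Ascending xs (λ i j i≤j → asc (suc i) (suc j) (s≤s i≤j)))

isEven-idP : ∀ n → isEven (idP n) ≡ true
isEven-idP n = cong isEvenℕ (invCount-Ascending (idP n) λ i j i≤j →
  subst₂ _≤_ (cong toℕ (sym (lookup-idP i))) (cong toℕ (sym (lookup-idP j))) i≤j)

-- Coset decompositions

inverse : ∀ {n} (w : Perm n) → Distinct w → Perm n
inverse w w-inj = tabulate (λ y → proj₁ (Distinct⇒surjective w w-inj y))

lookup-inverseʳ : ∀ {n} (w : Perm n) (w-inj : Distinct w) y →
                  lookup w (lookup (inverse w w-inj) y) ≡ y
lookup-inverseʳ w w-inj y =
  trans (cong (lookup w) (Vec.lookup∘tabulate _ y)) (proj₂ (Distinct⇒surjective w w-inj y))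

lookup-inverseˡ : ∀ {n} (w : Perm n) (w-inj : Distinct w) x →
                  lookup (inverse w w-inj) (lookup w x) ≡ x
lookup-inverseˡ w w-inj x = w-inj (lookup-inverseʳ w w-inj (lookup w x))

inverse-Distinct : ∀ {n} (w : Perm n) (w-inj : Distinct w) → Distinct (inverse w w-inj)
inverse-Distinct w w-inj {x} {y} eq =
  trans (sym (lookup-inverseʳ w w-inj x)) (trans (cong (lookup w) eq) (lookup-inverseʳ w w-inj y))

∘P-inverse-∘P : ∀ {n} (u w : Perm n) (w-inj : Distinct w) → (u ∘P inverse w w-inj) ∘P w ≡ u
∘P-inverse-∘P u w w-inj = lookup-extensionality λ x → begin
  lookup ((u ∘P w⁻¹) ∘P w) x         ≡⟨ lookup-∘P (u ∘P w⁻¹) w x ⟩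
  lookup (u ∘P w⁻¹) (lookup w x)     ≡⟨ lookup-∘P u w⁻¹ (lookup w x) ⟩
  lookup u (lookup w⁻¹ (lookup w x)) ≡⟨ cong (lookup u) (lookup-inverseˡ w w-inj x) ⟩
  lookup u x                         ∎
  where open ≡-Reasoning; w⁻¹ = inverse w w-inj

∘P-∘P-inverse : ∀ {n} (u w : Perm n) (w-inj : Distinct w) → (u ∘P w) ∘P inverse w w-inj ≡ u
∘P-∘P-inverse u w w-inj = lookup-extensionality λ y → begin
  lookup ((u ∘P w) ∘P w⁻¹) y         ≡⟨ lookup-∘P (u ∘P w) w⁻¹ y ⟩
  lookup (u ∘P w) (lookup w⁻¹ y)     ≡⟨ lookup-∘P u w (lookup w⁻¹ y) ⟩
  lookup u (lookup w (lookup w⁻¹ y)) ≡⟨ cong (lookup u) (lookup-inverseʳ w w-inj y) ⟩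
  lookup u y                         ∎
  where open ≡-Reasoning; w⁻¹ = inverse w w-inj

∘P-cancelʳ : ∀ {n} (u u′ w : Perm n) → Distinct w → u ∘P w ≡ u′ ∘P w → u ≡ u′
∘P-cancelʳ u u′ w w-inj eq = begin
  u                           ≡⟨ ∘P-∘P-inverse u w w-inj ⟨
  (u ∘P w) ∘P inverse w w-inj  ≡⟨ cong (_∘P inverse w w-inj) eq ⟩
  (u′ ∘P w) ∘P inverse w w-inj ≡⟨ ∘P-∘P-inverse u′ w w-inj ⟩
  u′                          ∎
  where open ≡-Reasoning

-- The subgroup S_c (or A_c, when ok = isEven) of permutations fixing every point ≥ c;
-- points are numbered from 0.
InSub : ∀ {n} → (Perm n → Bool) → ℕ → Perm n → Set
InSub ok c w = Distinct w × FixesFrom c w × ok w ≡ true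

-- Since r k sends T ∸ k to T, the representative of the coset of w is read off w⁻¹(T).
module CosetStep {N T : ℕ} (T<N : T < N) (ok : Perm N → Bool) (r : ℕ → Perm N)
  (r-Distinct  : ∀ {k} → k ≤ T → Distinct (r k))
  (r-FixesFrom : ∀ {k} → k ≤ T → FixesFrom (suc T) (r k))
  (r-hits      : ∀ {k} → k ≤ T → ∀ x → toℕ x ℕ.+ k ≡ T → toℕ (lookup (r k) x) ≡ T)
  (ok-∘P-r     : ∀ {k} → k ≤ T → ∀ u → Distinct u → ok (u ∘P r k) ≡ ok u)
  where

  top : Fin N
  top = fromℕ< T<N

  toℕ≡T⇒≡top : ∀ {x} → toℕ x ≡ T → x ≡ top
  toℕ≡T⇒≡top eq = Fin.toℕ-injective (trans eq (sym (Fin.toℕ-fromℕ< T<N)))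

  preimage : ℕ → Fin N
  preimage k = fromℕ< (ℕ.≤-<-trans (ℕ.m∸n≤m T k) T<N)

  ∘P-r-InSub : ∀ {u k} → InSub ok T u → k ≤ T → InSub ok (suc T) (u ∘P r k)
  ∘P-r-InSub {u} {k} (u-inj , u-fix , u-ok) k≤T =
    ∘P-Distinct u (r k) u-inj (r-Distinct k≤T) ,
    ∘P-FixesFrom u (r k) (FixesFrom-mono u (ℕ.n≤1+n T) u-fix) (r-FixesFrom k≤T) ,
    trans (ok-∘P-r k≤T u u-inj) u-ok

  ∘P-r-preimage : ∀ {u k} → InSub ok T u → k ≤ T → lookup (u ∘P r k) (preimage k) ≡ top
  ∘P-r-preimage {u} {k} (_ , u-fix , _) k≤T = begin
    lookup (u ∘P r k) (preimage k)     ≡⟨ lookup-∘P u (r k) (preimage k) ⟩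
    lookup u (lookup (r k) (preimage k)) ≡⟨ cong (lookup u) r-preimage ⟩
    lookup u top                       ≡⟨ u-fix top (ℕ.≤-reflexive (sym (Fin.toℕ-fromℕ< T<N))) ⟩
    top                                ∎
    where
    open ≡-Reasoning
    r-preimage : lookup (r k) (preimage k) ≡ top
    r-preimage = toℕ≡T⇒≡top (r-hits k≤T (preimage k)
      (trans (cong (ℕ._+ k) (Fin.toℕ-fromℕ< _)) (ℕ.m∸n+n≡m k≤T)))

  InSub-split : ∀ {w} → InSub ok (suc T) w →
                ∃₂ λ k u → k ≤ T × InSub ok T u × u ∘P r k ≡ w
  InSub-split {w} (w-inj , w-fix , w-ok) = k , u , k≤T , (u-inj , u-fix , u-ok) , u∘r≡w
    where
    p : Fin N
    p = proj₁ (Distinct⇒surjective w w-inj top)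
    wp≡top : lookup w p ≡ top
    wp≡top = proj₂ (Distinct⇒surjective w w-inj top)
    p≤T : toℕ p ≤ T
    p≤T = ℕ.≮⇒≥ λ T<p → ℕ.<-irrefl
      (trans (sym (Fin.toℕ-fromℕ< T<N)) (cong toℕ (trans (sym wp≡top) (w-fix p T<p)))) T<p
    k = T ∸ toℕ p
    k≤T = ℕ.m∸n≤m T (toℕ p)
    r⁻¹ = inverse (r k) (r-Distinct k≤T)
    u = w ∘P r⁻¹
    u∘r≡w : u ∘P r k ≡ w
    u∘r≡w = ∘P-inverse-∘P w (r k) (r-Distinct k≤T)
    u-inj : Distinct u
    u-inj = ∘P-Distinct w r⁻¹ w-inj (inverse-Distinct (r k) (r-Distinct k≤T))
    r⁻¹-fixes : ∀ {x} → lookup (r k) x ≡ x → lookup r⁻¹ x ≡ x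
    r⁻¹-fixes {x} rx≡x =
      trans (cong (lookup r⁻¹) (sym rx≡x)) (lookup-inverseˡ (r k) (r-Distinct k≤T) x)
    r⁻¹-top : lookup r⁻¹ top ≡ p
    r⁻¹-top = trans (cong (lookup r⁻¹) (sym rp≡top)) (lookup-inverseˡ (r k) (r-Distinct k≤T) p)
      where
      rp≡top = toℕ≡T⇒≡top (r-hits k≤T p (ℕ.m+[n∸m]≡n p≤T))
    u-fix : FixesFrom T u
    u-fix x T≤x with toℕ x ℕ.≟ T
    ... | yes x≡T rewrite toℕ≡T⇒≡top x≡T =
      trans (lookup-∘P w r⁻¹ top) (trans (cong (lookup w) r⁻¹-top) wp≡top)
    ... | no x≢T = trans (lookup-∘P w r⁻¹ x) (trans (cong (lookup w) (r⁻¹-fixes (r-FixesFrom k≤T x T<x)))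
                                                    (w-fix x T<x))
      where T<x = ℕ.≤∧≢⇒< T≤x (x≢T ∘ sym)
    u-ok : ok u ≡ true
    u-ok = trans (sym (ok-∘P-r k≤T u u-inj)) (trans (cong ok u∘r≡w) w-ok)

  ∘P-r-injective : ∀ {u u′ k k′} → InSub ok T u → InSub ok T u′ → k ≤ T → k′ ≤ T →
                   u ∘P r k ≡ u′ ∘P r k′ → k ≡ k′ × u ≡ u′
  ∘P-r-injective {u} {u′} {k} {k′} u∈ u′∈ k≤T k′≤T eq = k≡k′ , u≡u′
    where
    same-preimage : preimage k ≡ preimage k′
    same-preimage = ∘P-Distinct u (r k) (proj₁ u∈) (r-Distinct k≤T)
      (trans (∘P-r-preimage u∈ k≤T) (sym (trans (cong (λ v → lookup v (preimage k′)) eq)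
                                                (∘P-r-preimage u′∈ k′≤T))))
    k≡k′ : k ≡ k′
    k≡k′ = begin
      k           ≡⟨ ℕ.m∸[m∸n]≡n k≤T ⟨
      T ∸ (T ∸ k)  ≡⟨ cong (T ∸_) (trans (sym (Fin.toℕ-fromℕ< _))
                                         (trans (cong toℕ same-preimage) (Fin.toℕ-fromℕ< _))) ⟩
      T ∸ (T ∸ k′) ≡⟨ ℕ.m∸[m∸n]≡n k′≤T ⟩
      k′          ∎
      where open ≡-Reasoning
    u≡u′ : u ≡ u′
    u≡u′ = ∘P-cancelʳ u u′ (r k) (r-Distinct k≤T) (trans eq (cong (λ j → u′ ∘P r j) (sym k≡k′)))

concatMap-map≡cartesianProductWith :
  ∀ {A B C : Set} (g : A → B → C) xs ys →
  concatMap (λ x → List.map (g x) ys) xs ≡ cartesianProductWith g xs ys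
concatMap-map≡cartesianProductWith g []       ys = refl
concatMap-map≡cartesianProductWith g (x ∷ xs) ys =
  cong (List.map (g x) ys ++_) (concatMap-map≡cartesianProductWith g xs ys)

choices-suc : ∀ b m → choices b (suc m) ≡ cartesianProductWith _∷ʳ_ (choices b m) (upTo (suc (b (suc m))))
choices-suc b m = concatMap-map≡cartesianProductWith _∷ʳ_ (choices b m) _

length-choices : ∀ b m {ks} → ks ∈ choices b m → List.length ks ≡ m
length-choices b zero    (here refl) = refl
length-choices b (suc m) ks∈ rewrite choices-suc b m
  with ks , k , ks∈′ , _ , refl ← ∈-cartesianProductWith⁻ _∷ʳ_ (choices b m) _ ks∈
  = trans (List.length-++ ks) (trans (ℕ.+-comm _ 1) (cong suc (length-choices b m ks∈′)))

∈-choices⁻ : ∀ b m {x} → x ∈ choices b (suc m) →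
             ∃₂ λ ks k → ks ∈ choices b m × k ≤ b (suc m) × x ≡ ks ∷ʳ k
∈-choices⁻ b m x∈ rewrite choices-suc b m
  with ks , k , ks∈ , k∈ , eq ← ∈-cartesianProductWith⁻ _∷ʳ_ (choices b m) _ x∈
  = ks , k , ks∈ , ℕ.≤-pred (∈-upTo⁻ k∈) , eq

∈-choices⁺ : ∀ b m {ks k} → ks ∈ choices b m → k ≤ b (suc m) → ks ∷ʳ k ∈ choices b (suc m)
∈-choices⁺ b m ks∈ k≤ rewrite choices-suc b m = ∈-cartesianProductWith⁺ _∷ʳ_ ks∈ (∈-upTo⁺ (s≤s k≤))

choices-Unique : ∀ b m → Unique (choices b m)
choices-Unique b zero    = All.[] AllPairs.∷ AllPairs.[]
choices-Unique b (suc m) rewrite choices-suc b m =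
  Unique.cartesianProductWith⁺ _∷ʳ_ (λ {w} {x} → List.∷ʳ-injective w x)
                               (choices-Unique b m) (Unique.upTo⁺ _)

module Factorization {N : ℕ} (b : ℕ → ℕ) (e : ℕ → ℕ → Perm N) (M : ℕ) (P : ℕ → Perm N → Set)
  (P-idP      : P 0 (idP N))
  (P-zero⇒idP : ∀ {w} → P 0 w → w ≡ idP N)
  (∘P-e-P     : ∀ {m u k} → suc m ≤ M → P m u → k ≤ b (suc m) → P (suc m) (u ∘P e (suc m) k))
  (P-split    : ∀ {m w} → suc m ≤ M → P (suc m) w →
                ∃₂ λ k u → k ≤ b (suc m) × P m u × u ∘P e (suc m) k ≡ w)
  (∘P-e-injective : ∀ {m u u′ k k′} → suc m ≤ M → P m u → P m u′ →
                    k ≤ b (suc m) → k′ ≤ b (suc m) → u ∘P e (suc m) k ≡ u′ ∘P e (suc m) k′ → k ≡ k′ × u ≡ u′)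
  where

  prod : List ℕ → Perm N
  prod = prodFrom e (idP N) 1

  prodFrom-∷ʳ : ∀ j ks k →
                prodFrom e (idP N) j (ks ∷ʳ k) ≡ prodFrom e (idP N) j ks ∘P e (j ℕ.+ List.length ks) k
  prodFrom-∷ʳ j []        k = begin
    e j k ∘P idP N           ≡⟨ ∘P-identityʳ (e j k) ⟩
    e j k                    ≡⟨ ∘P-identityˡ (e j k) ⟨
    idP N ∘P e j k           ≡⟨ cong (λ i → idP N ∘P e i k) (ℕ.+-identityʳ j) ⟨
    idP N ∘P e (j ℕ.+ 0) k   ∎
    where open ≡-Reasoning
  prodFrom-∷ʳ j (k′ ∷ ks) k = begin
    e j k′ ∘P prodFrom e (idP N) (suc j) (ks ∷ʳ k)
      ≡⟨ cong (e j k′ ∘P_) (prodFrom-∷ʳ (suc j) ks k) ⟩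
    e j k′ ∘P (prodFrom e (idP N) (suc j) ks ∘P e (suc j ℕ.+ List.length ks) k)
      ≡⟨ ∘P-assoc (e j k′) (prodFrom e (idP N) (suc j) ks) _ ⟩
    (e j k′ ∘P prodFrom e (idP N) (suc j) ks) ∘P e (suc j ℕ.+ List.length ks) k
      ≡⟨ cong (λ i → (e j k′ ∘P prodFrom e (idP N) (suc j) ks) ∘P e i k) (ℕ.+-suc j _) ⟨
    (e j k′ ∘P prodFrom e (idP N) (suc j) ks) ∘P e (j ℕ.+ suc (List.length ks)) k
      ∎
    where open ≡-Reasoning

  prod-∷ʳ : ∀ {m ks} k → ks ∈ choices b m → prod (ks ∷ʳ k) ≡ prod ks ∘P e (suc m) k
  prod-∷ʳ {m} {ks} k ks∈ =
    trans (prodFrom-∷ʳ 1 ks k) (cong (λ i → prod ks ∘P e (suc i) k) (length-choices b m ks∈))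

  prod-P : ∀ {m ks} → m ≤ M → ks ∈ choices b m → P m (prod ks)
  prod-P {zero}  _   (here refl) = P-idP
  prod-P {suc m} m<M x∈
    with ks , k , ks∈ , k≤ , refl ← ∈-choices⁻ b m x∈
    rewrite prod-∷ʳ k ks∈
    = ∘P-e-P m<M (prod-P (ℕ.<⇒≤ m<M) ks∈) k≤

  P⇒prod : ∀ {m w} → m ≤ M → P m w → ∃ λ ks → ks ∈ choices b m × prod ks ≡ w
  P⇒prod {zero}  _   w∈ = [] , here refl , sym (P-zero⇒idP w∈)
  P⇒prod {suc m} m<M w∈
    with k , u , k≤ , u∈ , u∘e≡w ← P-split m<M w∈
    with ks , ks∈ , prod≡u ← P⇒prod (ℕ.<⇒≤ m<M) u∈
    = ks ∷ʳ k , ∈-choices⁺ b m ks∈ k≤ ,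
      trans (prod-∷ʳ k ks∈) (trans (cong (_∘P e (suc m) k) prod≡u) u∘e≡w)

  prod-injective : ∀ {m ks ks′} → m ≤ M → ks ∈ choices b m → ks′ ∈ choices b m →
                   prod ks ≡ prod ks′ → ks ≡ ks′
  prod-injective {zero}  _   (here refl) (here refl) _ = refl
  prod-injective {suc m} m<M x∈ x′∈ eq
    with ks  , k  , ks∈  , k≤  , refl ← ∈-choices⁻ b m x∈
    with ks′ , k′ , ks′∈ , k′≤ , refl ← ∈-choices⁻ b m x′∈
    with refl , prod≡ ← ∘P-e-injective m<M (prod-P (ℕ.<⇒≤ m<M) ks∈) (prod-P (ℕ.<⇒≤ m<M) ks′∈)
                          k≤ k′≤ (trans (sym (prod-∷ʳ k ks∈)) (trans eq (prod-∷ʳ k′ ks′∈)))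
    = cong (_∷ʳ k) (prod-injective (ℕ.<⇒≤ m<M) ks∈ ks′∈ prod≡)

fixes-last-point : ∀ {n} (w : Perm n) (p : Fin n) → Distinct w →
                   (∀ x → x ≢ p → lookup w x ≡ x) → lookup w p ≡ p
fixes-last-point w p w-inj fixes with lookup w p Fin.≟ p
... | yes wp≡p = wp≡p
... | no  wp≢p = ⊥-elim (wp≢p (w-inj (fixes (lookup w p) wp≢p)))

FixesFrom-below : ∀ {n c} (w : Perm n) → Distinct w → FixesFrom c w →
                  ∀ x → toℕ x < c → toℕ (lookup w x) < c
FixesFrom-below {c = c} w w-inj w-fix x x<c = ℕ.≰⇒> λ c≤wx →
  ℕ.<⇒≱ x<c (subst (λ y → c ≤ toℕ y) (w-inj (w-fix (lookup w x) c≤wx)) c≤wx)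

FixesFrom-1⇒idP : ∀ {n} (w : Perm n) → Distinct w → FixesFrom 1 w → w ≡ idP n
FixesFrom-1⇒idP {zero}  [] _     _     = refl
FixesFrom-1⇒idP {suc n} w  w-inj w-fix = lookup-extensionality λ x → trans (fixes x) (sym (lookup-idP x))
  where
  fixes-≢0 : ∀ (x : Fin (suc n)) → x ≢ zero → lookup w x ≡ x
  fixes-≢0 zero    x≢0 = ⊥-elim (x≢0 refl)
  fixes-≢0 (suc x) _   = w-fix (suc x) (s≤s z≤n)
  fixes : ∀ x → lookup w x ≡ x
  fixes zero    = fixes-last-point w zero w-inj fixes-≢0
  fixes (suc x) = fixes-≢0 (suc x) λ ()

idP-or-s₁ : ∀ {n} {w : Perm (suc (suc n))} → Distinct w → FixesFrom 2 w →
            w ≡ idP (suc (suc n)) ⊎ w ≡ s (suc (suc n)) 1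
idP-or-s₁ {w = w} w-inj w-fix with lookup w zero in w0≡
... | zero = inj₁ (lookup-extensionality λ x → trans (fixes x) (sym (lookup-idP x)))
  where
  fixes-≢1 : ∀ x → x ≢ suc zero → lookup w x ≡ x
  fixes-≢1 zero          _   = w0≡
  fixes-≢1 (suc zero)    x≢1 = ⊥-elim (x≢1 refl)
  fixes-≢1 (suc (suc x)) _   = w-fix (suc (suc x)) (s≤s (s≤s z≤n))
  fixes : ∀ x → lookup w x ≡ x
  fixes zero          = w0≡
  fixes (suc zero)    = fixes-last-point w (suc zero) w-inj fixes-≢1
  fixes (suc (suc x)) = w-fix (suc (suc x)) (s≤s (s≤s z≤n))
... | suc (suc y) = ⊥-elim (ℕ.<⇒≱ (FixesFrom-below w w-inj w-fix zero (s≤s z≤n))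
                                   (subst (λ v → 2 ≤ toℕ v) (sym w0≡) (s≤s (s≤s z≤n))))
... | suc zero with lookup w (suc zero) in w1≡
...   | suc zero    = case w-inj (trans w0≡ (sym w1≡)) of λ ()
...   | suc (suc y) = ⊥-elim (ℕ.<⇒≱ (FixesFrom-below w w-inj w-fix (suc zero) (s≤s (s≤s z≤n)))
                                     (subst (λ v → 2 ≤ toℕ v) (sym w1≡) (s≤s (s≤s z≤n))))
...   | zero        = inj₂ (lookup-extensionality λ x → trans (swaps x) (sym (lookup-s _ 0 x)))
  where
  swaps : ∀ x → lookup w x ≡ swapAt 0 x
  swaps zero          = w0≡
  swaps (suc zero)    = w1≡
  swaps (suc (suc x)) = w-fix (suc (suc x)) (s≤s (s≤s z≤n))

isEven-s₁ : ∀ n → isEven (s (suc (suc n)) 1) ≡ false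
isEven-s₁ n = begin
  isEven (s N 1)             ≡⟨ cong isEven (∘P-identityˡ (s N 1)) ⟨
  isEven (idP N ∘P s N 1)    ≡⟨ isEven-∘P-s (idP N) 0 idP-Distinct (s≤s (s≤s z≤n)) ⟩
  not (isEven (idP N))       ≡⟨ cong not (isEven-idP N) ⟩
  false                      ∎
  where open ≡-Reasoning; N = suc (suc n)

InSub-isEven-2⇒idP : ∀ {n} {w : Perm n} → InSub isEven 2 w → w ≡ idP n
InSub-isEven-2⇒idP {zero}        {[]}         _ = refl
InSub-isEven-2⇒idP {suc zero}    {zero ∷ []}  _ = refl
InSub-isEven-2⇒idP {suc (suc n)} (w-inj , w-fix , w-even) with idP-or-s₁ w-inj w-fix
... | inj₁ w≡idP = w≡idP
... | inj₂ refl  = case trans (sym w-even) (isEven-s₁ n) of λ ()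

FixesFrom-size : ∀ {n} (w : Perm n) → FixesFrom n w
FixesFrom-size w x n≤x = ⊥-elim (ℕ.<⇒≱ (Fin.toℕ<n x) n≤x)

suc≤∸1⇒< : ∀ {m n} → suc m ≤ n ∸ 1 → suc m < n
suc≤∸1⇒< {n = suc n} le = s≤s le

-- The factorizations of the symmetric and alternating groups

module _ (n : ℕ) where

  descS-Distinct : ∀ j k → Distinct (descS n j k)
  descS-Distinct j zero    = idP-Distinct
  descS-Distinct j (suc k) =
    ∘P-Distinct (s n j) (descS n (j ∸ 1) k) (s-Distinct n j) (descS-Distinct (j ∸ 1) k)

  descS-FixesFrom : ∀ j k → FixesFrom (suc j) (descS n j k)
  descS-FixesFrom j zero    x _ = lookup-idP x
  descS-FixesFrom j (suc k) =
    ∘P-FixesFrom (s n j) (descS n (j ∸ 1) k) (s-FixesFrom n j)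
      (FixesFrom-mono (descS n (j ∸ 1) k) (s≤s (ℕ.m∸n≤m j 1)) (descS-FixesFrom (j ∸ 1) k))

  descS-hits : ∀ j k → k ≤ j → j < n → ∀ x → toℕ x ℕ.+ k ≡ j → toℕ (lookup (descS n j k) x) ≡ j
  descS-hits j       zero    _         _   x eq = trans (cong toℕ (lookup-idP x)) (trans (sym (ℕ.+-identityʳ _)) eq)
  descS-hits (suc j) (suc k) (s≤s k≤j) j<n x eq = begin
    toℕ (lookup (s n (suc j) ∘P descS n j k) x)        ≡⟨ cong toℕ (lookup-∘P (s n (suc j)) (descS n j k) x) ⟩
    toℕ (lookup (s n (suc j)) (lookup (descS n j k) x)) ≡⟨ cong toℕ (lookup-s n j _) ⟩
    toℕ (swapAt j (lookup (descS n j k) x))            ≡⟨ toℕ-swapAt-up j _ ih j<n ⟩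
    suc j                                              ∎
    where
    open ≡-Reasoning
    ih = descS-hits j k k≤j (ℕ.<⇒≤ j<n) x (ℕ.suc-injective (trans (sym (ℕ.+-suc _ _)) eq))

module SymmetricFactorization (n : ℕ) where

  private
    module Step (m : ℕ) (m<M : suc m ≤ n ∸ 1) =
      CosetStep (suc≤∸1⇒< m<M) (λ _ → true) (descS n (suc m))
        (λ {k} _ → descS-Distinct n (suc m) k) (λ {k} _ → descS-FixesFrom n (suc m) k)
        (λ {k} k≤ → descS-hits n (suc m) k k≤ (suc≤∸1⇒< m<M)) (λ _ _ _ → refl)

    open Factorization (λ j → j) (elemS n) (n ∸ 1) (λ m → InSub (λ _ → true) (suc m))
      (idP-Distinct , (λ x _ → lookup-idP x) , refl)
      (λ {w} (w-inj , w-fix , _) → FixesFrom-1⇒idP w w-inj w-fix)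
      (λ {m} {u} {k} m<M → Step.∘P-r-InSub m m<M {u} {k})
      (λ {m} {w} m<M → Step.InSub-split m m<M {w})
      (λ {m} {u} {u′} {k} {k′} m<M → Step.∘P-r-injective m m<M {u} {u′} {k} {k′})

  prodS-Distinct : ∀ {ks} → ks ∈ choicesS n → Distinct (prodS n ks)
  prodS-Distinct ks∈ = proj₁ (prod-P ℕ.≤-refl ks∈)

  Distinct⇒prodS : ∀ {w} → Distinct w → ∃ λ ks → ks ∈ choicesS n × prodS n ks ≡ w
  Distinct⇒prodS {w} w-inj =
    P⇒prod ℕ.≤-refl (w-inj , FixesFrom-mono w (ℕ.m≤n+m∸n n 1) (FixesFrom-size w) , refl)

  prodS-injective : ∀ {ks ks′} → ks ∈ choicesS n → ks′ ∈ choicesS n →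
                    prodS n ks ≡ prodS n ks′ → ks ≡ ks′
  prodS-injective = prod-injective ℕ.≤-refl

module _ (n : ℕ) where

  private
    N = suc n

  a-Distinct : ∀ i → Distinct (a n i)
  a-Distinct i = ∘P-Distinct (s N 1) (s N (suc i)) (s-Distinct N 1) (s-Distinct N (suc i))

  a1inv-Distinct : Distinct (a1inv n)
  a1inv-Distinct = ∘P-Distinct (s N 2) (s N 1) (s-Distinct N 2) (s-Distinct N 1)

  descA-Distinct : ∀ j k → Distinct (descA n j k)
  descA-Distinct j zero    = idP-Distinct
  descA-Distinct j (suc k) =
    ∘P-Distinct (a n j) (descA n (j ∸ 1) k) (a-Distinct j) (descA-Distinct (j ∸ 1) k)

  elemA-Distinct : ∀ j k → Distinct (elemA n j k)
  elemA-Distinct j k with k ≤ᵇ j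
  ... | true  = descA-Distinct j k
  ... | false = ∘P-Distinct (descA n j (j ∸ 1)) (a1inv n) (descA-Distinct j (j ∸ 1)) a1inv-Distinct

  a-FixesFrom : ∀ i → FixesFrom (suc (suc i)) (a n i)
  a-FixesFrom i = ∘P-FixesFrom (s N 1) (s N (suc i))
    (FixesFrom-mono (s N 1) (s≤s (s≤s z≤n)) (s-FixesFrom N 1)) (s-FixesFrom N (suc i))

  a1inv-FixesFrom : FixesFrom 3 (a1inv n)
  a1inv-FixesFrom = ∘P-FixesFrom (s N 2) (s N 1)
    (s-FixesFrom N 2) (FixesFrom-mono (s N 1) (s≤s (s≤s z≤n)) (s-FixesFrom N 1))

  descA-FixesFrom : ∀ j k → FixesFrom (suc (suc j)) (descA n j k)
  descA-FixesFrom j zero    x _ = lookup-idP x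
  descA-FixesFrom j (suc k) = ∘P-FixesFrom (a n j) (descA n (j ∸ 1) k) (a-FixesFrom j)
    (FixesFrom-mono (descA n (j ∸ 1) k) (s≤s (s≤s (ℕ.m∸n≤m j 1))) (descA-FixesFrom (j ∸ 1) k))

  elemA-FixesFrom : ∀ j k → 1 ≤ j → FixesFrom (suc (suc j)) (elemA n j k)
  elemA-FixesFrom j k 1≤j with k ≤ᵇ j
  ... | true  = descA-FixesFrom j k
  ... | false = ∘P-FixesFrom (descA n j (j ∸ 1)) (a1inv n) (descA-FixesFrom j (j ∸ 1))
                  (FixesFrom-mono (a1inv n) (s≤s (s≤s 1≤j)) a1inv-FixesFrom)

  descA-hits : ∀ j k → k ≤ j → j < n → ∀ x → toℕ x ℕ.+ k ≡ suc j →
               toℕ (lookup (descA n j k) x) ≡ suc j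
  descA-hits j       zero    _         _   x eq = trans (cong toℕ (lookup-idP x)) (trans (sym (ℕ.+-identityʳ _)) eq)
  descA-hits (suc j) (suc k) (s≤s k≤j) j<n x eq = begin
    toℕ (lookup (a n (suc j) ∘P descA n j k) x)           ≡⟨ cong toℕ (lookup-∘P (a n (suc j)) (descA n j k) x) ⟩
    toℕ (lookup (s N 1 ∘P s N (suc (suc j))) y)           ≡⟨ cong toℕ (lookup-∘P (s N 1) (s N (suc (suc j))) y) ⟩
    toℕ (lookup (s N 1) (lookup (s N (suc (suc j))) y))   ≡⟨ cong toℕ (s-FixesFrom N 1 _ 2≤sy) ⟩
    toℕ (lookup (s N (suc (suc j))) y)                    ≡⟨ toℕ-sy ⟩
    suc (suc j)                                          ∎
    where
    open ≡-Reasoning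
    y = lookup (descA n j k) x
    toℕ-y : toℕ y ≡ suc j
    toℕ-y = descA-hits j k k≤j (ℕ.<⇒≤ j<n) x (ℕ.suc-injective (trans (sym (ℕ.+-suc _ _)) eq))
    toℕ-sy : toℕ (lookup (s N (suc (suc j))) y) ≡ suc (suc j)
    toℕ-sy = trans (cong toℕ (lookup-s N (suc j) y)) (toℕ-swapAt-up (suc j) y toℕ-y (s≤s j<n))
    2≤sy : 2 ≤ toℕ (lookup (s N (suc (suc j))) y)
    2≤sy = subst (2 ≤_) (sym toℕ-sy) (s≤s (s≤s z≤n))

  a1inv-hits : 1 < n → toℕ (lookup (a1inv n) zero) ≡ 2
  a1inv-hits 1<n = begin
    toℕ (lookup (s N 2 ∘P s N 1) zero)              ≡⟨ cong toℕ (lookup-∘P (s N 2) (s N 1) zero) ⟩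
    toℕ (lookup (s N 2) (lookup (s N 1) zero))      ≡⟨ cong toℕ (lookup-s N 1 _) ⟩
    toℕ (swapAt 1 (lookup (s N 1) zero))            ≡⟨ toℕ-swapAt-up 1 _ toℕ-s₁0 (s≤s 1<n) ⟩
    2                                               ∎
    where
    open ≡-Reasoning
    toℕ-s₁0 : toℕ (lookup (s N 1) zero) ≡ 1
    toℕ-s₁0 = trans (cong toℕ (lookup-s N 0 zero)) (toℕ-swapAt-up 0 zero refl (s≤s (ℕ.<-trans (s≤s z≤n) 1<n)))

  elemA-hits : ∀ j k → k ≤ suc j → 1 ≤ j → j < n → ∀ x → toℕ x ℕ.+ k ≡ suc j →
               toℕ (lookup (elemA n j k) x) ≡ suc j
  elemA-hits j k k≤ 1≤j j<n x eq with k ≤ᵇ j in k≤ᵇj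
  ... | true  = descA-hits j k (ℕ.≤ᵇ⇒≤ k j (≡true⇒T k≤ᵇj)) j<n x eq
  ... | false = begin
    toℕ (lookup (descA n j (j ∸ 1) ∘P a1inv n) x)
      ≡⟨ cong toℕ (lookup-∘P (descA n j (j ∸ 1)) (a1inv n) x) ⟩
    toℕ (lookup (descA n j (j ∸ 1)) (lookup (a1inv n) x))
      ≡⟨ descA-hits j (j ∸ 1) (ℕ.m∸n≤m j 1) j<n _ toℕ-a1inv-x+ ⟩
    suc j
      ∎
    where
    open ≡-Reasoning
    k≡sj : k ≡ suc j
    k≡sj = ℕ.≤-antisym k≤ (ℕ.≰⇒> (subst T k≤ᵇj ∘ ℕ.≤⇒≤ᵇ))
    x≡0 : x ≡ zero
    x≡0 = Fin.toℕ-injective (ℕ.+-cancelʳ-≡ (suc j) (toℕ x) 0 (trans (cong (toℕ x ℕ.+_) (sym k≡sj)) eq))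
    toℕ-a1inv-x+ : toℕ (lookup (a1inv n) x) ℕ.+ (j ∸ 1) ≡ suc j
    toℕ-a1inv-x+ = trans (cong (λ y → toℕ (lookup (a1inv n) y) ℕ.+ (j ∸ 1)) x≡0)
      (trans (cong (ℕ._+ (j ∸ 1)) (a1inv-hits (ℕ.≤-<-trans 1≤j j<n))) (cong suc (ℕ.m+[n∸m]≡n 1≤j)))

  a-ParityPreserving : ∀ i → i < n → ParityPreserving (a n i)
  a-ParityPreserving i i<n = s∘s-ParityPreserving 0 i (s≤s (ℕ.≤-<-trans z≤n i<n)) (s≤s i<n)

  descA-ParityPreserving : ∀ j k → j < n → ParityPreserving (descA n j k)
  descA-ParityPreserving j zero    _   = idP-ParityPreserving
  descA-ParityPreserving j (suc k) j<n =
    ∘P-ParityPreserving (a n j) (descA n (j ∸ 1) k) (a-Distinct j) (a-ParityPreserving j j<n)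
    (descA-ParityPreserving (j ∸ 1) k (ℕ.≤-<-trans (ℕ.m∸n≤m j 1) j<n))

  elemA-ParityPreserving : ∀ j k → 1 ≤ j → j < n → ParityPreserving (elemA n j k)
  elemA-ParityPreserving j k 1≤j j<n with k ≤ᵇ j
  ... | true  = descA-ParityPreserving j k j<n
  ... | false = ∘P-ParityPreserving (descA n j (j ∸ 1)) (a1inv n)
                  (descA-Distinct j (j ∸ 1)) (descA-ParityPreserving j (j ∸ 1) j<n)
                  (s∘s-ParityPreserving 1 0 (s≤s 1<n) (s≤s (ℕ.<-trans (s≤s z≤n) 1<n)))
    where 1<n = ℕ.≤-<-trans 1≤j j<n

module AlternatingFactorization (n : ℕ) where

  private
    module Step (m : ℕ) (m<M : suc m ≤ n ∸ 1) =
      CosetStep (s≤s (suc≤∸1⇒< m<M)) isEven (elemA n (suc m))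
        (λ {k} _ → elemA-Distinct n (suc m) k) (λ {k} _ → elemA-FixesFrom n (suc m) k (s≤s z≤n))
        (λ {k} k≤ → elemA-hits n (suc m) k k≤ (s≤s z≤n) (suc≤∸1⇒< m<M))
        (λ {k} _ → elemA-ParityPreserving n (suc m) k (s≤s z≤n) (suc≤∸1⇒< m<M))

    open Factorization suc (elemA n) (n ∸ 1) (λ m → InSub isEven (suc (suc m)))
      (idP-Distinct , (λ x _ → lookup-idP x) , isEven-idP (suc n))
      InSub-isEven-2⇒idP
      (λ {m} {u} {k} m<M → Step.∘P-r-InSub m m<M {u} {k})
      (λ {m} {w} m<M → Step.InSub-split m m<M {w})
      (λ {m} {u} {u′} {k} {k′} m<M → Step.∘P-r-injective m m<M {u} {u′} {k} {k′})

  prodA-Distinct : ∀ {ks} → ks ∈ choicesA n → Distinct (prodA n ks)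
  prodA-Distinct ks∈ = proj₁ (prod-P ℕ.≤-refl ks∈)

  prodA-even : ∀ {ks} → ks ∈ choicesA n → isEven (prodA n ks) ≡ true
  prodA-even ks∈ = proj₂ (proj₂ (prod-P ℕ.≤-refl ks∈))

  even⇒prodA : ∀ {w} → Distinct w → isEven w ≡ true → ∃ λ ks → ks ∈ choicesA n × prodA n ks ≡ w
  even⇒prodA {w} w-inj w-even =
    P⇒prod ℕ.≤-refl (w-inj , FixesFrom-mono w (s≤s (ℕ.m≤n+m∸n n 1)) (FixesFrom-size w) , w-even)

  prodA-injective : ∀ {ks ks′} → ks ∈ choicesA n → ks′ ∈ choicesA n →
                    prodA n ks ≡ prodA n ks′ → ks ≡ ks′
  prodA-injective = prod-injective ℕ.≤-refl

module Sums {c ℓ : Level} (R : CommutativeSemiring c ℓ) where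

  open CommutativeSemiring R renaming (refl to ≈-refl; sym to ≈-sym; trans to ≈-trans)
  open import Relation.Binary.Reasoning.Setoid setoid

  Σ[_] : ∀ {X : Set} → (X → Carrier) → List X → Carrier
  Σ[_] = sumR R

  Σ-↭ : ∀ {X : Set} (g : X → Carrier) {xs ys} → xs ↭ ys → Σ[ g ] xs ≈ Σ[ g ] ys
  Σ-↭ g {xs} {ys} xs↭ys = begin
    Σ[ g ] xs                          ≡⟨ List.foldr-map _+_ g 0# xs ⟨
    List.foldr _+_ 0# (List.map g xs)  ≈⟨ ↭ₛ.foldr-commMonoid setoid +-isCommutativeMonoid
                                            (↭⇒↭ₛ′ isEquivalence (↭.map⁺ g xs↭ys)) ⟩
    List.foldr _+_ 0# (List.map g ys)  ≡⟨ List.foldr-map _+_ g 0# ys ⟩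
    Σ[ g ] ys                          ∎

  Σ-map : ∀ {X Y : Set} (g : Y → Carrier) (h : X → Y) xs → Σ[ g ] (List.map h xs) ≡ Σ[ g ∘ h ] xs
  Σ-map g h = List.foldr-map _ h 0#

  Σ-cong-∈ : ∀ {X : Set} {g h : X → Carrier} xs → (∀ {x} → x ∈ xs → g x ≈ h x) → Σ[ g ] xs ≈ Σ[ h ] xs
  Σ-cong-∈ []       _   = ≈-refl
  Σ-cong-∈ (x ∷ xs) g≈h = +-cong (g≈h (here refl)) (Σ-cong-∈ xs (g≈h ∘ there))

  Σ-++ : ∀ {X : Set} (g : X → Carrier) xs ys → Σ[ g ] (xs ++ ys) ≈ Σ[ g ] xs + Σ[ g ] ys
  Σ-++ g []       ys = ≈-sym (+-identityˡ _)
  Σ-++ g (x ∷ xs) ys = begin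
    g x + Σ[ g ] (xs ++ ys)          ≈⟨ +-congˡ (Σ-++ g xs ys) ⟩
    g x + (Σ[ g ] xs + Σ[ g ] ys)    ≈⟨ +-assoc _ _ _ ⟨
    (g x + Σ[ g ] xs) + Σ[ g ] ys    ∎

  Σ-∷ʳ : ∀ {X : Set} (g : X → Carrier) xs x → Σ[ g ] (xs ∷ʳ x) ≈ Σ[ g ] xs + g x
  Σ-∷ʳ g xs x = ≈-trans (Σ-++ g xs (x ∷ [])) (+-congˡ (+-identityʳ (g x)))

  Σ-cartesianProductWith : ∀ {X Y Z : Set} (g : Z → Carrier) (h : X → Y → Z) xs ys →
    Σ[ g ] (cartesianProductWith h xs ys) ≈ Σ[ (λ x → Σ[ g ∘ h x ] ys) ] xs
  Σ-cartesianProductWith g h []       ys = ≈-refl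
  Σ-cartesianProductWith g h (x ∷ xs) ys = begin
    Σ[ g ] (List.map (h x) ys ++ cartesianProductWith h xs ys)
      ≈⟨ Σ-++ g (List.map (h x) ys) (cartesianProductWith h xs ys) ⟩
    Σ[ g ] (List.map (h x) ys) + Σ[ g ] (cartesianProductWith h xs ys)
      ≈⟨ +-cong (reflexive (Σ-map g (h x) ys)) (Σ-cartesianProductWith g h xs ys) ⟩
    Σ[ g ∘ h x ] ys + Σ[ (λ x → Σ[ g ∘ h x ] ys) ] xs
      ∎

  Σ-*ˡ : ∀ {X : Set} (c : Carrier) (g : X → Carrier) xs → Σ[ (λ x → c * g x) ] xs ≈ c * Σ[ g ] xs
  Σ-*ˡ c g []       = ≈-sym (zeroʳ c)
  Σ-*ˡ c g (x ∷ xs) = begin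
    c * g x + Σ[ (λ x → c * g x) ] xs   ≈⟨ +-congˡ (Σ-*ˡ c g xs) ⟩
    c * g x + c * Σ[ g ] xs             ≈⟨ distribˡ c _ _ ⟨
    c * (g x + Σ[ g ] xs)               ∎

  Σ-choices-suc : ∀ (g : List ℕ → Carrier) b m →
    Σ[ g ] (choices b (suc m)) ≈ Σ[ (λ ks → Σ[ (λ k → g (ks ∷ʳ k)) ] (upTo (suc (b (suc m))))) ] (choices b m)
  Σ-choices-suc g b m =
    ≈-trans (reflexive (cong Σ[ g ] (choices-suc b m)))
            (Σ-cartesianProductWith g _∷ʳ_ (choices b m) (upTo (suc (b (suc m)))))

-- The map f on choice sequences

fChoice : ℕ → ℕ → ℕ
fChoice j k = if k ≤ᵇ j then k else j

fChoices : ℕ → List ℕ → List ℕ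
fChoices j []       = []
fChoices j (k ∷ ks) = fChoice j k ∷ fChoices (suc j) ks

isDelS : ℕ → ℕ → Bool
isDelS j k = k ≡ᵇ j

isDelA : ℕ → ℕ → Bool
isDelA j k = j ≤ᵇ k

suc≤ᵇsuc : ∀ a b → (suc a ≤ᵇ suc b) ≡ (a ≤ᵇ b)
suc≤ᵇsuc zero    b = refl
suc≤ᵇsuc (suc a) b = refl

isDelA≡isDelS∘fChoice : ∀ j k → isDelA j k ≡ isDelS j (fChoice j k)
isDelA≡isDelS∘fChoice zero    zero    = refl
isDelA≡isDelS∘fChoice zero    (suc k) = refl
isDelA≡isDelS∘fChoice (suc j) zero    = refl
isDelA≡isDelS∘fChoice (suc j) (suc k)
  rewrite suc≤ᵇsuc j k | suc≤ᵇsuc k j | isDelA≡isDelS∘fChoice j k with k ≤ᵇ j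
... | true  = refl
... | false = refl

countFrom-fChoices : ∀ j ks → countFrom isDelA j ks ≡ countFrom isDelS j (fChoices j ks)
countFrom-fChoices j []       = refl
countFrom-fChoices j (k ∷ ks) =
  cong₂ (λ b c → bit b ℕ.+ c) (isDelA≡isDelS∘fChoice j k) (countFrom-fChoices (suc j) ks)

prodFrom-fElem : ∀ n j ks → prodFrom (fElem n) (idP n) j ks ≡ prodFrom (elemS n) (idP n) j (fChoices j ks)
prodFrom-fElem n j []       = refl
prodFrom-fElem n j (k ∷ ks) = cong₂ _∘P_ fElem≡elemS (prodFrom-fElem n (suc j) ks)
  where
  fElem≡elemS : fElem n j k ≡ elemS n j (fChoice j k)
  fElem≡elemS with k ≤ᵇ j
  ... | true  = refl
  ... | false = refl

fChoices-∷ʳ : ∀ j ks k → fChoices j (ks ∷ʳ k) ≡ fChoices j ks ∷ʳ fChoice (j ℕ.+ List.length ks) k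
fChoices-∷ʳ j []        k = cong (λ i → fChoice i k ∷ []) (sym (ℕ.+-identityʳ j))
fChoices-∷ʳ j (k′ ∷ ks) k = cong (fChoice j k′ ∷_)
  (trans (fChoices-∷ʳ (suc j) ks k) (cong (λ i → fChoices (suc j) ks ∷ʳ fChoice i k) (sym (ℕ.+-suc j _))))

countFrom-∷ʳ : ∀ p j ks k → countFrom p j (ks ∷ʳ k) ≡ countFrom p j ks ℕ.+ bit (p (j ℕ.+ List.length ks) k)
countFrom-∷ʳ p j []        k = trans (ℕ.+-identityʳ _) (cong (λ i → bit (p i k)) (sym (ℕ.+-identityʳ j)))
countFrom-∷ʳ p j (k′ ∷ ks) k = begin
  bit (p j k′) ℕ.+ countFrom p (suc j) (ks ∷ʳ k)
    ≡⟨ cong (bit (p j k′) ℕ.+_) (countFrom-∷ʳ p (suc j) ks k) ⟩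
  bit (p j k′) ℕ.+ (countFrom p (suc j) ks ℕ.+ bit (p (suc j ℕ.+ List.length ks) k))
    ≡⟨ ℕ.+-assoc (bit (p j k′)) _ _ ⟨
  countFrom p j (k′ ∷ ks) ℕ.+ bit (p (suc j ℕ.+ List.length ks) k)
    ≡⟨ cong (λ i → countFrom p j (k′ ∷ ks) ℕ.+ bit (p i k)) (ℕ.+-suc j _) ⟨
  countFrom p j (k′ ∷ ks) ℕ.+ bit (p (j ℕ.+ suc (List.length ks)) k)
    ∎
  where open ≡-Reasoning

fChoice-≤ : ∀ {j k} → k ≤ j → fChoice j k ≡ k
fChoice-≤ {j} {k} k≤j rewrite T⇒≡true (ℕ.≤⇒≤ᵇ k≤j) = refl

fChoice-suc : ∀ j → fChoice j (suc j) ≡ j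
fChoice-suc j rewrite refutes⇒≡false (ℕ.≤ᵇ⇒≤ (suc j) j) (ℕ.<-irrefl refl) = refl

isDelS-< : ∀ {j k} → k < j → isDelS j k ≡ false
isDelS-< {j} {k} k<j = refutes⇒≡false (ℕ.≡ᵇ⇒≡ k j) (ℕ.<⇒≢ k<j)

isDelS-refl : ∀ j → isDelS j j ≡ true
isDelS-refl j = T⇒≡true (ℕ.≡⇒≡ᵇ j j refl)

module Fibres {c ℓ : Level} (R : CommutativeSemiring c ℓ) where

  open CommutativeSemiring R renaming (refl to ≈-refl; sym to ≈-sym; trans to ≈-trans)
  open import Algebra.Definitions.RawSemiring rawSemiring using (_^_)
  open import Algebra.Properties.Semiring.Exp semiring using (^-homo-*)
  open import Relation.Binary.Reasoning.Setoid setoid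
  open Sums R

  two : Carrier
  two = 1# + 1#

  doubling : ∀ x → two ^ 1 * x ≈ x + x
  doubling x = begin
    (two * 1#) * x         ≈⟨ *-congʳ (*-identityʳ two) ⟩
    (1# + 1#) * x          ≈⟨ distribʳ x 1# 1# ⟩
    1# * x + 1# * x        ≈⟨ +-cong (*-identityˡ x) (*-identityˡ x) ⟩
    x + x                  ∎

  Σ-fChoice : ∀ (F : ℕ → Carrier) j →
    Σ[ F ∘ fChoice j ] (upTo (suc (suc j))) ≈ Σ[ (λ k → two ^ bit (isDelS j k) * F k) ] (upTo (suc j))
  Σ-fChoice F j = begin
    Σ[ F ∘ fChoice j ] (upTo (suc (suc j)))
      ≡⟨ cong Σ[ F ∘ fChoice j ] (trans (sym (List.upTo-∷ʳ (suc j)))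
                                        (cong (_∷ʳ suc j) (sym (List.upTo-∷ʳ j)))) ⟩
    Σ[ F ∘ fChoice j ] ((upTo j ∷ʳ j) ∷ʳ suc j)
      ≈⟨ ≈-trans (Σ-∷ʳ _ (upTo j ∷ʳ j) (suc j)) (+-congʳ (Σ-∷ʳ _ (upTo j) j)) ⟩
    (Σ[ F ∘ fChoice j ] (upTo j) + F (fChoice j j)) + F (fChoice j (suc j))
      ≈⟨ +-cong (+-cong lower-terms (reflexive (cong F (fChoice-≤ ℕ.≤-refl))))
                (reflexive (cong F (fChoice-suc j))) ⟩
    (Σ[ F ] (upTo j) + F j) + F j
      ≈⟨ +-assoc _ _ _ ⟩
    Σ[ F ] (upTo j) + (F j + F j)
      ≈⟨ +-cong lower-terms′ top-term ⟨
    Σ[ G ] (upTo j) + G j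
      ≈⟨ Σ-∷ʳ G (upTo j) j ⟨
    Σ[ G ] (upTo j ∷ʳ j)
      ≡⟨ cong Σ[ G ] (List.upTo-∷ʳ j) ⟩
    Σ[ G ] (upTo (suc j))
      ∎
    where
    G : ℕ → Carrier
    G k = two ^ bit (isDelS j k) * F k
    lower-terms : Σ[ F ∘ fChoice j ] (upTo j) ≈ Σ[ F ] (upTo j)
    lower-terms = Σ-cong-∈ (upTo j) λ k∈ → reflexive (cong F (fChoice-≤ (ℕ.<⇒≤ (∈-upTo⁻ k∈))))
    top-term : G j ≈ F j + F j
    top-term = ≈-trans (*-congʳ (reflexive (cong (λ b → two ^ bit b) (isDelS-refl j)))) (doubling (F j))
    lower-terms′ : Σ[ G ] (upTo j) ≈ Σ[ F ] (upTo j)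
    lower-terms′ = Σ-cong-∈ (upTo j) λ k∈ →
      ≈-trans (*-congʳ (reflexive (cong (λ b → two ^ bit b) (isDelS-< (∈-upTo⁻ k∈))))) (*-identityˡ _)

  weight : List ℕ → Carrier
  weight cs = two ^ countFrom isDelS 1 cs

  weight-∷ʳ : ∀ {m} cs k → List.length cs ≡ m → weight (cs ∷ʳ k) ≈ weight cs * two ^ bit (isDelS (suc m) k)
  weight-∷ʳ cs k refl = ≈-trans (reflexive (cong (two ^_) (countFrom-∷ʳ isDelS 1 cs k)))
                                (^-homo-* two (countFrom isDelS 1 cs) _)

  Σ-fChoices : ∀ m (H : List ℕ → Carrier) →
    Σ[ H ∘ fChoices 1 ] (choices suc m) ≈ Σ[ (λ cs → weight cs * H cs) ] (choices id m)
  Σ-fChoices zero    H = +-congʳ (≈-sym (*-identityˡ _))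
  Σ-fChoices (suc m) H = begin
    Σ[ H ∘ fChoices 1 ] (choices suc (suc m))
      ≈⟨ Σ-choices-suc (H ∘ fChoices 1) suc m ⟩
    Σ[ (λ ks → Σ[ (λ k → H (fChoices 1 (ks ∷ʳ k))) ] (upTo (3 ℕ.+ m))) ] (choices suc m)
      ≈⟨ Σ-cong-∈ (choices suc m) (λ ks∈ →
           Σ-cong-∈ (upTo (3 ℕ.+ m)) λ {k} _ → reflexive (cong H (extend ks∈ k))) ⟩
    Σ[ H′ ∘ fChoices 1 ] (choices suc m)
      ≈⟨ Σ-fChoices m H′ ⟩
    Σ[ (λ cs → weight cs * H′ cs) ] (choices id m)
      ≈⟨ Σ-cong-∈ (choices id m) fibre ⟩
    Σ[ (λ cs → Σ[ (λ k → weight (cs ∷ʳ k) * H (cs ∷ʳ k)) ] (upTo (2 ℕ.+ m))) ] (choices id m)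
      ≈⟨ Σ-choices-suc (λ cs → weight cs * H cs) id m ⟨
    Σ[ (λ cs → weight cs * H cs) ] (choices id (suc m))
      ∎
    where
    H′ : List ℕ → Carrier
    H′ cs = Σ[ (λ k → H (cs ∷ʳ fChoice (suc m) k)) ] (upTo (3 ℕ.+ m))
    extend : ∀ {ks} → ks ∈ choices suc m → ∀ k → fChoices 1 (ks ∷ʳ k) ≡ fChoices 1 ks ∷ʳ fChoice (suc m) k
    extend {ks} ks∈ k = trans (fChoices-∷ʳ 1 ks k)
      (cong (λ i → fChoices 1 ks ∷ʳ fChoice (suc i) k) (length-choices suc m ks∈))
    fibre : ∀ {cs} → cs ∈ choices id m →
            weight cs * H′ cs ≈ Σ[ (λ k → weight (cs ∷ʳ k) * H (cs ∷ʳ k)) ] (upTo (2 ℕ.+ m))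
    fibre {cs} cs∈ = begin
      weight cs * H′ cs
        ≈⟨ *-congˡ (Σ-fChoice (H ∘ (cs ∷ʳ_)) (suc m)) ⟩
      weight cs * Σ[ (λ k → two ^ bit (isDelS (suc m) k) * H (cs ∷ʳ k)) ] (upTo (2 ℕ.+ m))
        ≈⟨ Σ-*ˡ (weight cs) _ (upTo (2 ℕ.+ m)) ⟨
      Σ[ (λ k → weight cs * (two ^ bit (isDelS (suc m) k) * H (cs ∷ʳ k))) ] (upTo (2 ℕ.+ m))
        ≈⟨ Σ-cong-∈ (upTo (2 ℕ.+ m)) (λ {k} _ → ≈-trans (≈-sym (*-assoc _ _ _))
                                          (*-congʳ (≈-sym (weight-∷ʳ cs k (length-choices id m cs∈))))) ⟩
      Σ[ (λ k → weight (cs ∷ʳ k) * H (cs ∷ʳ k)) ] (upTo (2 ℕ.+ m))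
        ∎

allVecs-suc : ∀ n k → allVecs n (suc k) ≡ cartesianProductWith _∷_ (allFin n) (allVecs n k)
allVecs-suc n k = concatMap-map≡cartesianProductWith _∷_ (allFin n) (allVecs n k)

∈-allVecs : ∀ n k (v : Vec (Fin n) k) → v ∈ allVecs n k
∈-allVecs n zero    []      = here refl
∈-allVecs n (suc k) (x ∷ v) rewrite allVecs-suc n k =
  ∈-cartesianProductWith⁺ _∷_ (∈-allFin x) (∈-allVecs n k v)

allVecs-Unique : ∀ n k → Unique (allVecs n k)
allVecs-Unique n zero    = All.[] AllPairs.∷ AllPairs.[]
allVecs-Unique n (suc k) rewrite allVecs-suc n k =
  Unique.cartesianProductWith⁺ _∷_ Vec.∷-injective (Unique.allFin⁺ n) (allVecs-Unique n k)

Unique-↭ : ∀ {A : Set} {xs ys : List A} → Unique xs → Unique ys →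
           (∀ {x} → x ∈ xs → x ∈ ys) → (∀ {x} → x ∈ ys → x ∈ xs) → xs ↭ ys
Unique-↭ xs! ys! to from = ∼bag⇒↭ (unique∧set⇒bag xs! ys! (mk⇔ to from))

map-Unique : ∀ {A B : Set} (g : A → B) {xs} → Unique xs →
             (∀ {x y} → x ∈ xs → y ∈ xs → g x ≡ g y → x ≡ y) → Unique (List.map g xs)
map-Unique g {[]}     _                     _     = AllPairs.[]
map-Unique g {x ∷ xs} (x∉xs AllPairs.∷ xs!) g-inj =
  All.tabulate gx≢ AllPairs.∷ map-Unique g xs! (λ x∈ y∈ → g-inj (there x∈) (there y∈))
  where
  gx≢ : ∀ {z} → z ∈ List.map g xs → g x ≢ z
  gx≢ z∈ gx≡z with y , y∈ , refl ← ∈-map⁻ g z∈ = All.lookup x∉xs y∈ (g-inj (here refl) (there y∈) gx≡z)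

findᵇ-unique : ∀ {A : Set} (p : A → Bool) {xs x} → x ∈ xs → p x ≡ true →
               (∀ {y} → y ∈ xs → p y ≡ true → y ≡ x) → List.findᵇ p xs ≡ just x
findᵇ-unique p {y ∷ ys} x∈ px unique with p y in py
... | true  = cong just (unique (here refl) py)
... | false with x∈
...   | here refl = case trans (sym py) px of λ ()
...   | there x∈ys = findᵇ-unique p x∈ys px (unique ∘ there)

==P⇒≡ : ∀ {n} {u v : Perm n} → (u ==P v) ≡ true → u ≡ v
==P⇒≡ eq = toWitness (≡true⇒T eq)

==P-refl : ∀ {n} (u : Perm n) → (u ==P u) ≡ true
==P-refl u = T⇒≡true (fromWitness refl)

module _ (n : ℕ) where

  open SymmetricFactorization n
  open AlternatingFactorization n

  ∈S-list⇒∈prodS : ∀ {w} → w ∈ S-list n → w ∈ List.map (prodS n) (choicesS n)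
  ∈S-list⇒∈prodS {w} w∈
    with ks , ks∈ , refl ← Distinct⇒prodS {w} (distinct⇒Distinct w
                             (T⇒≡true (proj₂ (∈-filter⁻ (T? ∘ inS) {xs = allVecs n n} w∈))))
    = ∈-map⁺ (prodS n) ks∈

  ∈prodS⇒∈S-list : ∀ {w} → w ∈ List.map (prodS n) (choicesS n) → w ∈ S-list n
  ∈prodS⇒∈S-list {w} w∈ with ks , ks∈ , refl ← ∈-map⁻ (prodS n) w∈ =
    ∈-filter⁺ (T? ∘ inS) (∈-allVecs n n (prodS n ks))
      (≡true⇒T (Distinct⇒distinct (prodS n ks) (prodS-Distinct ks∈)))

  inA-prodA : ∀ {ks} → ks ∈ choicesA n → inA (prodA n ks) ≡ true
  inA-prodA {ks} ks∈ rewrite Distinct⇒distinct (prodA n ks) (prodA-Distinct ks∈) = prodA-even ks∈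

  ∈A-list⇒∈prodA : ∀ {w} → w ∈ A-list (suc n) → w ∈ List.map (prodA n) (choicesA n)
  ∈A-list⇒∈prodA {w} w∈
    with w∈A ← T⇒≡true (proj₂ (∈-filter⁻ (T? ∘ inA) {xs = allVecs (suc n) (suc n)} w∈))
    with ks , ks∈ , refl ← even⇒prodA {w} (distinct⇒Distinct w (∧-conicalˡ (distinct w) _ w∈A))
                                          (∧-conicalʳ (distinct w) _ w∈A)
    = ∈-map⁺ (prodA n) ks∈

  ∈prodA⇒∈A-list : ∀ {w} → w ∈ List.map (prodA n) (choicesA n) → w ∈ A-list (suc n)
  ∈prodA⇒∈A-list {w} w∈ with ks , ks∈ , refl ← ∈-map⁻ (prodA n) w∈ =
    ∈-filter⁺ (T? ∘ inA) (∈-allVecs (suc n) (suc n) (prodA n ks)) (≡true⇒T (inA-prodA ks∈))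

  S-list↭prodS : S-list n ↭ List.map (prodS n) (choicesS n)
  S-list↭prodS = Unique-↭ (Unique.filter⁺ (T? ∘ inS) (allVecs-Unique n n))
    (map-Unique (prodS n) (choices-Unique id (n ∸ 1)) prodS-injective) ∈S-list⇒∈prodS ∈prodS⇒∈S-list

  A-list↭prodA : A-list (suc n) ↭ List.map (prodA n) (choicesA n)
  A-list↭prodA = Unique-↭ (Unique.filter⁺ (T? ∘ inA) (allVecs-Unique (suc n) (suc n)))
    (map-Unique (prodA n) (choices-Unique suc (n ∸ 1)) prodA-injective) ∈A-list⇒∈prodA ∈prodA⇒∈A-list

  factorS-prodS : ∀ {ks} → ks ∈ choicesS n → factorS n (prodS n ks) ≡ just ks
  factorS-prodS {ks} ks∈ = findᵇ-unique _ ks∈ (==P-refl (prodS n ks))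
    (λ ks′∈ eq → prodS-injective ks′∈ ks∈ (==P⇒≡ eq))

  factorA-prodA : ∀ {ks} → ks ∈ choicesA n → factorA n (prodA n ks) ≡ just ks
  factorA-prodA {ks} ks∈ = findᵇ-unique _ ks∈ (==P-refl (prodA n ks))
    (λ ks′∈ eq → prodA-injective ks′∈ ks∈ (==P⇒≡ eq))

  delS-prodS : ∀ {ks} → ks ∈ choicesS n → delS n (prodS n ks) ≡ countFrom isDelS 1 ks
  delS-prodS ks∈ rewrite factorS-prodS ks∈ = refl

  delA-prodA : ∀ {ks} → ks ∈ choicesA n → delA n (prodA n ks) ≡ countFrom isDelS 1 (fChoices 1 ks)
  delA-prodA {ks} ks∈ rewrite factorA-prodA ks∈ = countFrom-fChoices 1 ks

  f-prodA : ∀ {ks} → ks ∈ choicesA n → f n (prodA n ks) ≡ prodS n (fChoices 1 ks)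
  f-prodA {ks} ks∈ rewrite factorA-prodA ks∈ = prodFrom-fElem n 1 ks

module Summands {c ℓ : Level} (R : CommutativeSemiring c ℓ) (mS mA : Statistic) (n : ℕ)
             (q t : CommutativeSemiring.Carrier R) where

  open CommutativeSemiring R hiding (refl; sym; trans)
  open import Algebra.Definitions.RawSemiring rawSemiring using (_^_)
  open import Algebra.Properties.CommutativeSemiring.Exp R using (^-distrib-*)
  open import Relation.Binary.Reasoning.Setoid setoid
  open Fibres R using (two; weight)

  termA : Perm (suc n) → Carrier
  termA v = q ^ mA (suc n) v * t ^ delA n v

  termS : Perm n → Carrier
  termS w = q ^ mS n w * (two * t) ^ delS n w

  termF : List ℕ → Carrier
  termF cs = q ^ mS n (prodS n cs) * t ^ countFrom isDelS 1 cs

  termA-prodA : IsFPair mS mA → ∀ {ks} → ks ∈ choicesA n → termA (prodA n ks) ≈ termF (fChoices 1 ks)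
  termA-prodA f-pair {ks} ks∈ = reflexive (cong₂ (λ i j → q ^ i * t ^ j)
    (trans (f-pair n (prodA n ks) (inA-prodA n ks∈)) (cong (mS n) (f-prodA n ks∈)))
    (delA-prodA n ks∈))

  weight*termF : ∀ {cs} → cs ∈ choicesS n → weight cs * termF cs ≈ termS (prodS n cs)
  weight*termF {cs} cs∈ rewrite delS-prodS n cs∈ = begin
    two ^ d * (q ^ m * t ^ d)   ≈⟨ *-assoc _ _ _ ⟨
    (two ^ d * q ^ m) * t ^ d   ≈⟨ *-congʳ (*-comm _ _) ⟩
    (q ^ m * two ^ d) * t ^ d   ≈⟨ *-assoc _ _ _ ⟩
    q ^ m * (two ^ d * t ^ d)   ≈⟨ *-congˡ (^-distrib-* two t d) ⟨
    q ^ m * (two * t) ^ d       ∎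
    where
    d = countFrom isDelS 1 cs
    m = mS n (prodS n cs)

proposition5p6 : (mS mA : Statistic) → IsFPair mS mA →
    (n : ℕ) → 2 ≤ n →
    ∀ {c ℓ} (R : CommutativeSemiring c ℓ) (q t : CommutativeSemiring.Carrier R) →
    CommutativeSemiring._≈_ R (genA R mA n q t) (genS R mS n q t)
proposition5p6 mS mA f-pair n _ R q t = begin
  Σ[ termA ] (A-list (suc n))                        ≈⟨ Σ-↭ termA (A-list↭prodA n) ⟩
  Σ[ termA ] (List.map (prodA n) (choicesA n))        ≡⟨ Σ-map termA (prodA n) (choicesA n) ⟩
  Σ[ termA ∘ prodA n ] (choicesA n)                   ≈⟨ Σ-cong-∈ (choicesA n) (termA-prodA f-pair) ⟩
  Σ[ termF ∘ fChoices 1 ] (choicesA n)                ≈⟨ Σ-fChoices (n ∸ 1) termF ⟩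
  Σ[ (λ cs → weight cs * termF cs) ] (choicesS n)     ≈⟨ Σ-cong-∈ (choicesS n) weight*termF ⟩
  Σ[ termS ∘ prodS n ] (choicesS n)                   ≡⟨ Σ-map termS (prodS n) (choicesS n) ⟨
  Σ[ termS ] (List.map (prodS n) (choicesS n))        ≈⟨ Σ-↭ termS (↭-sym (S-list↭prodS n)) ⟩
  Σ[ termS ] (S-list n)                               ∎
  where
  open CommutativeSemiring R using (setoid; _*_)
  open import Relation.Binary.Reasoning.Setoid setoid
  open Sums R
  open Fibres R
  open Summands R mS mA n q t
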